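{- Let $B$ be a minimum-weight basis of a weighted uncertainty matroid $\mathcal{M}=(E,\mathcal{I},A,w)$ and let $Q$ be a set that verifies $B$. Let $e\in B$ and $e'\notin B$ with $w_e=w_{e'}$ be such that $B'=(B\setminus\{e\})\cup\{e'\}$ is independent. If each $f\in\{e,e'\}$ is either trivial or contained in $Q$, then $Q$ also verifies $B'$.
   Context: A weighted uncertainty matroid $\mathcal{M}=(E,\mathcal{I},A,w)$ consists of a matroid $(E,\mathcal{I})$ on a finite set $E$, for each $e$ an uncertainty area $A_e\subseteq\mathbb{R}$ (a non-empty finite union of bounded real intervals, open or closed, single points allowed), and a weight $w_e\in A_e$. An element $e$ is trivial if $A_e=\{w_e\}$. A minimum-weight basis (MWB) minimizes $\sum_{e\in B}w_e$. A weight assignment consistent with $Q$ is $w^*$ with $w^*_e\in A_e$ for all $e$ and $w^*_e=w_e$ for $e\in Q$. $Q$ verifies the MWB $B$ if for every weight assignment $w^*$ consistent with $Q$, $B$ is an MWB of $(E,\mathcal{I},w^*)$. -}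

module Defs where

open import Level using (0ℓ)
open import Data.Bool using (Bool; true; false)
open import Data.Nat as ℕ using (ℕ; zero; suc)
open import Data.Fin using (Fin)
open import Data.Fin.Subset using (Subset; inside; outside; ⁅_⁆; _∪_; _-_; _∈_; _∉_; _⊆_; ∣_∣)
open import Data.Vec using (Vec; []; _∷_)
open import Data.List using (List)
open import Data.List.Relation.Unary.Any using (Any)
open import Data.Product using (Σ; ∃; _×_; _,_)
open import Data.Sum using (_⊎_)
open import Relation.Nullary using (¬_)
open import Relation.Binary.PropositionalEquality using (_≡_)
open import Function.Bundles using (_⇔_)

-- The paper uses ℝ, which agda-stdlib lacks; we
-- abstract over a totally ordered commutative group (ℝ under + and ≤
-- is an instance).

record OrderedAbGroup : Set₁ where
  infixl 6 _+_
  infix  4 _≤_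
  field
    Carrier : Set
    _+_     : Carrier → Carrier → Carrier
    0#      : Carrier
    -_      : Carrier → Carrier
    _≤_     : Carrier → Carrier → Set
    +-assoc : ∀ x y z → (x + y) + z ≡ x + (y + z)
    +-comm  : ∀ x y → x + y ≡ y + x
    +-idˡ   : ∀ x → 0# + x ≡ x
    -‿invˡ  : ∀ x → (- x) + x ≡ 0#
    ≤-refl  : ∀ x → x ≤ x
    ≤-trans : ∀ {x y z} → x ≤ y → y ≤ z → x ≤ z
    ≤-antisym : ∀ {x y} → x ≤ y → y ≤ x → x ≡ y
    ≤-total : ∀ x y → x ≤ y ⊎ y ≤ x
    +-monoˡ-≤ : ∀ {x y} z → x ≤ y → x + z ≤ y + z

module _ (R : OrderedAbGroup) where
  open OrderedAbGroup R

  _<_ : Carrier → Carrier → Set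
  x < y = x ≤ y × ¬ (x ≡ y)

  -- Bounded intervals (each end open or closed; a point is [a,a]).
  record Interval : Set where
    constructor interval
    field
      lo       : Carrier
      hi       : Carrier
      loClosed : Bool
      hiClosed : Bool

  LowerOK : Bool → Carrier → Carrier → Set
  LowerOK true  a x = a ≤ x
  LowerOK false a x = a < x

  UpperOK : Bool → Carrier → Carrier → Set
  UpperOK true  b x = x ≤ b
  UpperOK false b x = x < b

  _∈I_ : Carrier → Interval → Set
  x ∈I interval a b ca cb = LowerOK ca a x × UpperOK cb b x

  -- An uncertainty area: a finite union of bounded intervals.
  -- (Non-emptiness is implied by the requirement w_e ∈ A_e.)
  Area : Set
  Area = List Interval

  _∈A_ : Carrier → Area → Set
  x ∈A A = Any (x ∈I_) A

  weight : ∀ {n} → (Fin n → Carrier) → Subset n → Carrier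
  weight {zero}  w []             = 0#
  weight {suc n} w (inside  ∷ s)  = w Fin.zero + weight (λ i → w (Fin.suc i)) s
  weight {suc n} w (outside ∷ s)  = weight (λ i → w (Fin.suc i)) s

record IsMatroid {n : ℕ} (Ind : Subset n → Set) : Set where
  field
    empty-ind  : Ind Data.Fin.Subset.⊥
    down-closed : ∀ {X Y} → Y ⊆ X → Ind X → Ind Y
    exchange   : ∀ {X Y} → Ind X → Ind Y → ∣ X ∣ ℕ.< ∣ Y ∣ →
                 ∃ λ e → e ∈ Y × e ∉ X × Ind (X ∪ ⁅ e ⁆)

IsBasis : ∀ {n} → (Subset n → Set) → Subset n → Set
IsBasis Ind B = Ind B × (∀ X → Ind X → B ⊆ X → X ⊆ B)

module _ (R : OrderedAbGroup) where
  open OrderedAbGroup R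

  IsMWB : ∀ {n} → (Subset n → Set) → (Fin n → Carrier) → Subset n → Set
  IsMWB Ind w B = IsBasis Ind B × (∀ B′ → IsBasis Ind B′ → weight R w B ≤ weight R w B′)

  record UncertaintyMatroid (n : ℕ) : Set₁ where
    field
      Ind       : Subset n → Set
      isMatroid : IsMatroid Ind
      A         : Fin n → Area R
      w         : Fin n → Carrier
      w∈A       : ∀ e → _∈A_ R (w e) (A e)

  module _ {n} (M : UncertaintyMatroid n) where
    open UncertaintyMatroid M

    Trivial : Fin n → Set
    Trivial e = ∀ x → (_∈A_ R x (A e) ⇔ x ≡ w e)

    Consistent : Subset n → (Fin n → Carrier) → Set
    Consistent Q w* = (∀ e → _∈A_ R (w* e) (A e)) × (∀ e → e ∈ Q → w* e ≡ w e)

    Verifies : Subset n → Subset n → Set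
    Verifies Q B = ∀ w* → Consistent Q w* → IsMWB Ind w* B

-- Under any weight assignment w* consistent with Q, both e and e′ are pinned to their
-- known weights, so w*_e = w*_e′.  Hence B′ = B - e + e′ has the same size and the same
-- w*-weight as B.  An independent set of the size of a basis is a basis (the exchange
-- axiom would otherwise extend B), and a basis of the weight of an MWB is an MWB.
module Submission where

open import Defs hiding (_<_)
open import Data.Nat using (ℕ; suc; _<_)
open import Data.Fin using (Fin; zero; suc)
open import Data.Fin.Subset using (Subset; inside; outside; _∈_; _∉_; _∪_; _-_; ⁅_⁆; _⊆_; ∣_∣)
open import Data.Fin.Subset.Properties
  using (_∈?_; p─⊥≡p; p─q⊆p; ∪-identityʳ; p⊆p∪q; x∈p∪q⁺; x∈⁅x⁆; p⊂q⇒∣p∣<∣q∣)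
open import Data.Vec using (_∷_; here; there)
open import Data.Product using (_,_; proj₁)
open import Data.Sum using (_⊎_; inj₁; inj₂)
open import Data.Empty using (⊥-elim)
open import Function using (_∘_)
open import Function.Bundles using (Equivalence)
open import Relation.Nullary using (yes; no)
open import Relation.Binary.PropositionalEquality
  using (_≡_; sym; trans; cong; subst; module ≡-Reasoning)

module _ (R : OrderedAbGroup) where
  open OrderedAbGroup R

  private
    +-exchange : ∀ a b c → a + (b + c) ≡ b + (a + c)
    +-exchange a b c = begin
      a + (b + c)  ≡⟨ +-assoc a b c ⟨
      (a + b) + c  ≡⟨ cong (_+ c) (+-comm a b) ⟩
      (b + a) + c  ≡⟨ +-assoc b a c ⟩
      b + (a + c)  ∎
      where open ≡-Reasoning

  weight-insert : ∀ {n} (w : Fin n → Carrier) (p : Subset n) {x : Fin n} →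
               x ∉ p → weight R w (p ∪ ⁅ x ⁆) ≡ w x + weight R w p
  weight-insert w (outside ∷ p) {zero}  _   = cong (w zero +_) (cong (weight R _) (∪-identityʳ p))
  weight-insert w (inside  ∷ p) {zero}  x∉p = ⊥-elim (x∉p here)
  weight-insert w (outside ∷ p) {suc x} x∉p = weight-insert (w ∘ suc) p (x∉p ∘ there)
  weight-insert w (inside  ∷ p) {suc x} x∉p =
    trans (cong (w zero +_) (weight-insert (w ∘ suc) p (x∉p ∘ there))) (+-exchange _ _ _)

  weight-remove : ∀ {n} (w : Fin n → Carrier) (p : Subset n) {x : Fin n} →
               x ∈ p → weight R w p ≡ w x + weight R w (p - x)
  weight-remove w (inside  ∷ p) here        = cong (w zero +_) (sym (cong (weight R _) (p─⊥≡p p)))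
  weight-remove w (outside ∷ p) (there x∈p) = weight-remove (w ∘ suc) p x∈p
  weight-remove w (inside  ∷ p) (there x∈p) =
    trans (cong (w zero +_) (weight-remove (w ∘ suc) p x∈p)) (+-exchange _ _ _)

  weight-swap : ∀ {n} (w : Fin n → Carrier) {B : Subset n} {e e′ : Fin n} →
                e ∈ B → e′ ∉ B → w e ≡ w e′ → weight R w ((B - e) ∪ ⁅ e′ ⁆) ≡ weight R w B
  weight-swap w {B} {e} {e′} e∈B e′∉B we≡we′ = begin
    weight R w ((B - e) ∪ ⁅ e′ ⁆)  ≡⟨ weight-insert w (B - e) (e′∉B ∘ p─q⊆p B ⁅ e ⁆) ⟩
    w e′ + weight R w (B - e)      ≡⟨ cong (_+ weight R w (B - e)) we≡we′ ⟨
    w e  + weight R w (B - e)      ≡⟨ weight-remove w B e∈B ⟨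
    weight R w B                   ∎
    where open ≡-Reasoning

  IsMWB-resp-weight : ∀ {n} {Ind : Subset n → Set} {w : Fin n → Carrier} {B B′ : Subset n} →
                      IsMWB R Ind w B → IsBasis Ind B′ → weight R w B′ ≡ weight R w B →
                      IsMWB R Ind w B′
  IsMWB-resp-weight (_ , B-minimal) B′-basis wB′≡wB =
    B′-basis , λ B″ B″-basis → subst (_≤ _) (sym wB′≡wB) (B-minimal B″ B″-basis)

∣p∪⁅x⁆∣≡1+∣p∣ : ∀ {n} (p : Subset n) {x : Fin n} → x ∉ p → ∣ p ∪ ⁅ x ⁆ ∣ ≡ suc ∣ p ∣
∣p∪⁅x⁆∣≡1+∣p∣ (outside ∷ p) {zero}  _   = cong suc (cong ∣_∣ (∪-identityʳ p))
∣p∪⁅x⁆∣≡1+∣p∣ (inside  ∷ p) {zero}  x∉p = ⊥-elim (x∉p here)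
∣p∪⁅x⁆∣≡1+∣p∣ (outside ∷ p) {suc x} x∉p = ∣p∪⁅x⁆∣≡1+∣p∣ p (x∉p ∘ there)
∣p∪⁅x⁆∣≡1+∣p∣ (inside  ∷ p) {suc x} x∉p = cong suc (∣p∪⁅x⁆∣≡1+∣p∣ p (x∉p ∘ there))

x∈p⇒∣p∣≡1+∣p-x∣ : ∀ {n} (p : Subset n) {x : Fin n} → x ∈ p → ∣ p ∣ ≡ suc ∣ p - x ∣
x∈p⇒∣p∣≡1+∣p-x∣ (inside  ∷ p) here        = cong suc (sym (cong ∣_∣ (p─⊥≡p p)))
x∈p⇒∣p∣≡1+∣p-x∣ (outside ∷ p) (there x∈p) = x∈p⇒∣p∣≡1+∣p-x∣ p x∈p
x∈p⇒∣p∣≡1+∣p-x∣ (inside  ∷ p) (there x∈p) = cong suc (x∈p⇒∣p∣≡1+∣p-x∣ p x∈p)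

∣swap∣≡∣p∣ : ∀ {n} (p : Subset n) {e e′ : Fin n} → e ∈ p → e′ ∉ p → ∣ (p - e) ∪ ⁅ e′ ⁆ ∣ ≡ ∣ p ∣
∣swap∣≡∣p∣ p {e} e∈p e′∉p =
  trans (∣p∪⁅x⁆∣≡1+∣p∣ (p - e) (e′∉p ∘ p─q⊆p p ⁅ e ⁆)) (sym (x∈p⇒∣p∣≡1+∣p-x∣ p e∈p))

module _ {n} {Ind : Subset n → Set} (matroid : IsMatroid Ind) where

  IsBasis-resp-∣∣ : ∀ {B X : Subset n} → IsBasis Ind B → Ind X → ∣ X ∣ ≡ ∣ B ∣ → IsBasis Ind X
  IsBasis-resp-∣∣ {B} {X} (B-ind , B-maximal) X-ind ∣X∣≡∣B∣ = X-ind , X-maximal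
    where
    X-maximal : ∀ Y → Ind Y → X ⊆ Y → Y ⊆ X
    X-maximal Y Y-ind X⊆Y {y} y∈Y with y ∈? X
    ... | yes y∈X = y∈X
    ... | no  y∉X with IsMatroid.exchange matroid B-ind Y-ind ∣B∣<∣Y∣
      where
      ∣B∣<∣Y∣ : ∣ B ∣ < ∣ Y ∣
      ∣B∣<∣Y∣ = subst (_< ∣ Y ∣) ∣X∣≡∣B∣ (p⊂q⇒∣p∣<∣q∣ (X⊆Y , y , y∈Y , y∉X))
    ... | g , _ , g∉B , B+g-ind =
      ⊥-elim (g∉B (B-maximal (B ∪ ⁅ g ⁆) B+g-ind (p⊆p∪q ⁅ g ⁆) (x∈p∪q⁺ (inj₂ (x∈⁅x⁆ g)))))

module _ (R : OrderedAbGroup) {n} (M : UncertaintyMatroid R n) where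
  open UncertaintyMatroid M

  Consistent-fixes : ∀ {Q w* e} → Consistent R M Q w* → Trivial R M e ⊎ e ∈ Q → w* e ≡ w e
  Consistent-fixes {e = e} (w*∈A , _)  (inj₁ trivial) = Equivalence.to (trivial _) (w*∈A e)
  Consistent-fixes         (_ , w*≡w) (inj₂ e∈Q)     = w*≡w _ e∈Q

lemma2p12 : (R : OrderedAbGroup) {n : ℕ} (M : UncertaintyMatroid R n)
            (B Q : Subset n) (e e′ : Fin n) →
            IsMWB R (UncertaintyMatroid.Ind M) (UncertaintyMatroid.w M) B →
            Verifies R M Q B →
            e ∈ B → e′ ∉ B →
            UncertaintyMatroid.w M e ≡ UncertaintyMatroid.w M e′ →
            UncertaintyMatroid.Ind M ((B - e) ∪ ⁅ e′ ⁆) →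
            (Trivial R M e ⊎ e ∈ Q) →
            (Trivial R M e′ ⊎ e′ ∈ Q) →
            Verifies R M Q ((B - e) ∪ ⁅ e′ ⁆)
lemma2p12 R M B Q e e′ _ Q-verifies-B e∈B e′∉B we≡we′ B′-ind e-known e′-known w* consistent =
  IsMWB-resp-weight R B-MWB B′-basis (weight-swap R w* e∈B e′∉B w*e≡w*e′)
  where
  open UncertaintyMatroid M
  B-MWB    = Q-verifies-B w* consistent
  B′-basis = IsBasis-resp-∣∣ isMatroid (proj₁ B-MWB) B′-ind (∣swap∣≡∣p∣ B e∈B e′∉B)
  w*e≡w*e′ : w* e ≡ w* e′
  w*e≡w*e′ = trans (Consistent-fixes R M consistent e-known)
                   (trans we≡we′ (sym (Consistent-fixes R M consistent e′-known)))
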